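{- Let $v$ be a word of length $m$ with distinct entries, let $P$ be a marked reduced pipe dream of $v$, and let $j$ be an entry of $v$ such that pipe $j$ is removable in $P$. Let $v'$ be the word obtained from $v$ by deleting the entry $j$. Then $\Phi_j(P)$ is a marked reduced pipe dream of $v'$ (of rank $m-1$).
   Context: Pipe dreams. Let $v$ be a word (finite sequence of distinct positive integers) of length $m$ with entries $a_1<\cdots<a_m$. The staircase of rank $m$ consists of cells $(i,k)$, $i,k\ge1$, $i+k\le m+1$ (row $i$ counted from the top, column $k$ from the left). Fill each cell with a crossing tile (a vertical segment from top edge to bottom edge crossing a horizontal segment from right edge to left edge) or a bumping tile (one arc joining the top edge to the left edge, another joining the right edge to the bottom edge), with all cells satisfying $i+k=m+1$ bumping. The pipe labelled $a_k$ enters at the top of column $k$ and follows the segments, moving down and left, until it exits through the left boundary. The filling is a reduced pipe dream of $v$ if any two pipes meet in at most one crossing tile and the labels read on the left boundary from top to bottom form $v$. A marked reduced pipe dream of $v$ is a reduced pipe dream of $v$ together with a set of marked bumping tiles, where a bumping tile in row $i$ may be marked only if the two pipes passing through it cross at some crossing tile in a row strictly above row $i$. (For a permutation the labels are $1,\dots,n$.) Removable pipes. In a marked reduced pipe dream $P$, the pipe labelled $j$ is removable if: (i) the column where pipe $j$ enters consists, from top to bottom, of some crossing tiles all traversed by pipe $j$, followed by unmarked bumping tiles only; (ii) for each crossing tile traversed by pipe $j$, the tile directly above it (if any) is not an unmarked bumping tile; (iii) pipe $j$ traverses no marked bumping tile. The map $\Phi_j$. Let pipe $j$ be removable in $P$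 and let $c$ be the column where it enters. In each column $k<c$, pipe $j$ passes either through a single crossing tile $(r_k,k)$ horizontally, or through two vertically adjacent unmarked bumping tiles $(r_k,k),(r_k+1,k)$ (entering the first through its right edge, leaving the second through its left edge). Define $\Phi_j(P)$, a filling of the staircase of rank $m-1$, by: for $k>c$, column $k-1$ of $\Phi_j(P)$ is column $k$ of $P$ (same tiles and marks in the same rows); column $c$ of $P$ is deleted; for $k<c$, cells $(r,k)$ with $r<r_k$ keep their tiles and marks, and in the crossing case cell $(r,k)$ for $r\ge r_k$ receives the tile (with mark) of $(r+1,k)$ of $P$, while in the bumping case cell $(r_k,k)$ receives an unmarked bumping tile (formed by the upper-left half of the old $(r_k,k)$ and the lower-right half of the old $(r_k+1,k)$) and cell $(r,k)$ for $r>r_k$ receives the tile (with mark) of $(r+1,k)$ of $P$. Geometrically: delete column $c$ and the unit region traversed by pipe $j$ in each column to its left, then close the gaps. Pipes of $\Phi_j(P)$ are labelled by the entries of $v$ other than $j$, increasing from left to right. -}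

module Defs where

open import Data.Bool using (Bool; true; false)
open import Data.Nat using (ℕ; zero; suc; _+_; _*_; _≤_; _<_; _<?_; _≟_; _≤?_)
open import Data.Fin using (Fin; toℕ)
open import Data.List using (List; []; _∷_; length; filter; lookup)
open import Data.List.Membership.Propositional using (_∈_)
open import Data.Product using (_×_; _,_; ∃; ∃-syntax)
open import Relation.Nullary using (¬_; yes; no)
open import Relation.Nullary.Decidable using (¬?)
open import Relation.Binary.PropositionalEquality using (_≡_; _≢_)
open import Data.Maybe using (Maybe; just; nothing)

-- A tile is a crossing tile, or a bumping tile together with a flag
-- saying whether it is marked (true = marked).
data Tile : Set where
  cross : Tile
  bump  : Bool → Tile

-- A (marked) filling: tile in row i, column k (both 1-indexed, rows
-- counted from the top, columns from the left).  Only the values on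
-- the cells of the staircase are relevant.
Filling : Set
Filling = ℕ → ℕ → Tile

IsBump : Tile → Set
IsBump t = ∃ λ b → t ≡ bump b

InStair : ℕ → ℕ → ℕ → Set
InStair m i k = 1 ≤ i × 1 ≤ k × i + k ≤ suc m

data Dir : Set where
  fromTop fromRight : Dir

data Move : Set where
  down left : Move

move : Tile → Dir → Move
move cross    fromTop   = down
move cross    fromRight = left
move (bump _) fromTop   = left
move (bump _) fromRight = down

path : Filling → ℕ → ℕ → ℕ → Dir → List (ℕ × ℕ × Dir)
path F zero    i k d = []
path F (suc n) i k d = (i , k , d) ∷ continue (move (F i k) d) k
  where
  continue : Move → ℕ → List (ℕ × ℕ × Dir)
  continue down  k'            = path F n (suc i) k' fromTop
  continue left  zero          = []
  continue left  (suc zero)    = []                       -- exits at left boundary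
  continue left  (suc (suc k')) = path F n i (suc k') fromRight

exit : Filling → ℕ → ℕ → ℕ → Dir → Maybe ℕ
exit F zero    i k d = nothing
exit F (suc n) i k d = continue (move (F i k) d) k
  where
  continue : Move → ℕ → Maybe ℕ
  continue down  k'            = exit F n (suc i) k' fromTop
  continue left  zero          = nothing
  continue left  (suc zero)    = just i
  continue left  (suc (suc k')) = exit F n i (suc k') fromRight

fuel : ℕ → ℕ
fuel m = suc (m + m)

pipePath : Filling → ℕ → ℕ → List (ℕ × ℕ × Dir)
pipePath F m k = path F (fuel m) 1 k fromTop

pipeExit : Filling → ℕ → ℕ → Maybe ℕ
pipeExit F m k = exit F (fuel m) 1 k fromTop

Enters : Filling → ℕ → ℕ → ℕ → ℕ → Dir → Set
Enters F m k i c d = (i , c , d) ∈ pipePath F m k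

Visits : Filling → ℕ → ℕ → ℕ → ℕ → Set
Visits F m k i c = ∃ λ d → Enters F m k i c d

IsPipe : ℕ → ℕ → Set
IsPipe m k = 1 ≤ k × k ≤ m

-- number of entries of v smaller than x.  The pipe entering at the top
-- of column k is labelled by a_k, the k-th smallest entry of v, i.e.
-- the entry x of v with rank v x = k - 1.
rank : List ℕ → ℕ → ℕ
rank v x = length (filter (_<? x) v)

deleteEntry : ℕ → List ℕ → List ℕ
deleteEntry j v = filter (λ x → ¬? (x ≟ j)) v

record MarkedReducedPipeDream (v : List ℕ) (F : Filling) : Set where
  m : ℕ
  m = length v
  field
    antidiagonal : ∀ i k → 1 ≤ i → 1 ≤ k → i + k ≡ suc m → IsBump (F i k)
    -- labels on the left boundary, read from top to bottom, form v:
    -- the pipe entering column k+1 (labelled by the entry of rank k)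
    -- exits in the row r+1 with v_(r+1) that label
    reading : ∀ (k : Fin m) → ∃ λ (r : Fin m) →
      pipeExit F m (suc (toℕ k)) ≡ just (suc (toℕ r)) × rank v (lookup v r) ≡ toℕ k
    reduced : ∀ k₁ k₂ → IsPipe m k₁ → IsPipe m k₂ → k₁ ≢ k₂ →
      ∀ i c i' c' → InStair m i c → InStair m i' c' →
      F i c ≡ cross → F i' c' ≡ cross →
      Visits F m k₁ i c → Visits F m k₂ i c →
      Visits F m k₁ i' c' → Visits F m k₂ i' c' →
      i ≡ i' × c ≡ c'
    marks : ∀ i c → InStair m i c → F i c ≡ bump true →
      ∃ λ k₁ → ∃ λ k₂ → IsPipe m k₁ × IsPipe m k₂ ×
        Enters F m k₁ i c fromTop × Enters F m k₂ i c fromRight ×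
        ∃ λ i' → ∃ λ c' → i' < i × InStair m i' c' × F i' c' ≡ cross ×
          Visits F m k₁ i' c' × Visits F m k₂ i' c'

colOf : List ℕ → ℕ → ℕ
colOf v j = suc (rank v j)

record Removable (v : List ℕ) (j : ℕ) (F : Filling) : Set where
  m : ℕ
  m = length v
  c : ℕ
  c = colOf v j
  field
    column : ∃ λ t →
      (∀ i → 1 ≤ i → i ≤ t → F i c ≡ cross × Visits F m c i c) ×
      (∀ i → t < i → i + c ≤ suc m → F i c ≡ bump false)
    above : ∀ i k → InStair m (suc i) k → F (suc i) k ≡ cross →
      Visits F m c (suc i) k → F i k ≢ bump false
    noMarked : ∀ i k → InStair m i k → Visits F m c i k → F i k ≢ bump true

-- row of the first visited cell in column k of a path (0 if none)
firstRowIn : ℕ → List (ℕ × ℕ × Dir) → ℕ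
firstRowIn k [] = 0
firstRowIn k ((i , k' , d) ∷ xs) with k' ≟ k
... | yes _ = i
... | no  _ = firstRowIn k xs

rowIn : List ℕ → ℕ → Filling → ℕ → ℕ
rowIn v j F k = firstRowIn k (pipePath F (length v) (colOf v j))

leftCol : Filling → ℕ → ℕ → ℕ → Tile
leftCol F r i k with i <? r
... | yes _ = F i k
... | no  _ with F r k
...   | cross  = F (suc i) k
...   | bump _ with i ≟ r
...     | yes _ = bump false
...     | no  _ = F (suc i) k

Φ : List ℕ → ℕ → Filling → Filling
Φ v j F i k with k <? colOf v j
... | yes _ = leftCol F (rowIn v j F k) i k
... | no  _ = F i (suc k)

-- Pipes are walks of a deterministic step relation on states (cell, entry edge), of which path and exit are
-- fuel-bounded unfoldings. A removable pipe j descends column c through its crossings, turns left in row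
-- t+1 and then passes each column k < c in row r_k, through a crossing or through a vertical pair of
-- unmarked bumps. Closing the gaps left by Φ_j is a map collapse from states of P to states of Φ_j(P), and
-- every step of a pipe other than j is either mapped to a step of Φ_j(P) or absorbed (inside column c, or
-- where the pipe crosses pipe j left of c). So the pipes of Φ_j(P) are the images of the other pipes of P,
-- in the same order and exiting in the same rows except for the deleted row of j: this gives the reading
-- condition. Each tile of Φ_j(P) is the tile of a cell origin of P, and crossings of Φ_j(P) are images of
-- crossings of P met by the same pipes: this gives reducedness. A marked tile of Φ_j(P) comes from a marked
-- tile of P, whose justifying crossing stays strictly above it; the only delicate case is a mark on a
-- merged bump pair with the crossing one row higher, where the crossing must lie left of c and below pipe
-- j, hence is shifted up as well.

module Submission where

open import Data.Bool using (true; false)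
open import Data.Empty using (⊥; ⊥-elim)
open import Data.Fin using (Fin; toℕ; fromℕ<) renaming (zero to fzero; suc to fsuc)
open import Data.Fin.Properties using (toℕ-fromℕ<; toℕ-injective; toℕ<n)
open import Data.List using (List; []; _∷_; length; lookup)
open import Data.List.Properties using (filter-all; filter-notAll; filter-accept; filter-reject)
open import Data.List.Membership.Propositional using (_∈_)
open import Data.List.Membership.Propositional.Properties using (∈-lookup)
open import Data.List.Relation.Unary.All using (All)
import Data.List.Relation.Unary.All as All
open import Data.List.Relation.Unary.Any using (here; there)
import Data.List.Relation.Unary.Any as Any
open import Data.List.Relation.Unary.AllPairs using (_∷_)
open import Data.List.Relation.Unary.Unique.Propositional using (Unique)
open import Data.Maybe using (just)
open import Data.Nat
open import Data.Nat.Properties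
open import Data.Product using (∃; _×_; _,_; proj₁; proj₂; uncurry)
open import Data.Sum using (_⊎_; inj₁; inj₂)
open import Function using (_∘_; flip; id)
open import Relation.Binary using (tri<; tri≈; tri>)
open import Relation.Binary.PropositionalEquality
open import Relation.Binary.Rewriting using (Deterministic)
open import Relation.Binary.Construct.Closure.ReflexiveTransitive using (Star; ε; _◅_; _◅◅_; return; reverse)
open import Relation.Nullary using (¬_; Dec; yes; no)
open import Relation.Nullary.Decidable using (¬?)
open import Defs

-- Pipes as walks

Star-unsnoc : ∀ {A : Set} {T : A → A → Set} {a z} → Star T a z → a ≡ z ⊎ ∃ λ u → Star T a u × T u z
Star-unsnoc ε = inj₁ refl
Star-unsnoc (x ◅ p) with Star-unsnoc p
... | inj₁ refl = inj₂ (_ , ε , x)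
... | inj₂ (u , q , y) = inj₂ (u , x ◅ q , y)

det⇒Star-comparable : ∀ {A : Set} {T : A → A → Set} → Deterministic _≡_ T →
  ∀ {s a b} → Star T s a → Star T s b → Star T a b ⊎ Star T b a
det⇒Star-comparable det ε q = inj₁ q
det⇒Star-comparable det p ε = inj₂ p
det⇒Star-comparable det (x ◅ p) (y ◅ q) rewrite det x y = det⇒Star-comparable det p q

injective⇒Star-comparable : ∀ {A : Set} {T : A → A → Set} → Deterministic _≡_ (flip T) →
  ∀ {a b z} → Star T a z → Star T b z → Star T a b ⊎ Star T b a
injective⇒Star-comparable {T = T} inj p q
  with det⇒Star-comparable {T = flip T} inj (reverse id p) (reverse id q)
... | inj₁ r = inj₂ (reverse id r)
... | inj₂ r = inj₁ (reverse id r)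

-- A state (i , k , d) is a pipe entering cell (i , k) through edge d.
-- Column 0 is the left boundary: a pipe exiting at row e ends in (e , 0 , fromRight).
State : Set
State = ℕ × ℕ × Dir

row col : State → ℕ
row = proj₁
col s = proj₁ (proj₂ s)

data Step (F : Filling) : State → State → Set where
  stepDown : ∀ {i k d} → move (F i (suc k)) d ≡ down →
             Step F (i , suc k , d) (suc i , suc k , fromTop)
  stepLeft : ∀ {i k d} → move (F i (suc k)) d ≡ left →
             Step F (i , suc k , d) (i , k , fromRight)

Reach : Filling → State → State → Set
Reach F = Star (Step F)

move-injective : ∀ T {d d' mv} → move T d ≡ mv → move T d' ≡ mv → d ≡ d'
move-injective cross    {fromTop}   {fromTop}   _    _    = refl
move-injective cross    {fromRight} {fromRight} _    _    = refl
move-injective (bump _) {fromTop}   {fromTop}   _    _    = refl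
move-injective (bump _) {fromRight} {fromRight} _    _    = refl
move-injective cross    {fromTop}   {fromRight} refl ()
move-injective cross    {fromRight} {fromTop}   refl ()
move-injective (bump _) {fromTop}   {fromRight} refl ()
move-injective (bump _) {fromRight} {fromTop}   refl ()

bump-fromTop : ∀ {T} → IsBump T → move T fromTop ≡ left
bump-fromTop (_ , refl) = refl

left-fromRight⇒cross : ∀ {T} → move T fromRight ≡ left → T ≡ cross
left-fromRight⇒cross {cross} _ = refl

cross≢bump : ∀ {b} → cross ≢ bump b
cross≢bump ()

retile : ∀ {T T' d mv} → T' ≡ T → move T d ≡ mv → move T' d ≡ mv
retile refl mv = mv

down-fromTop⇒cross : ∀ {T} → move T fromTop ≡ down → T ≡ cross
down-fromTop⇒cross {cross} _ = refl

left-fromTop⇒bump : ∀ {T} → move T fromTop ≡ left → IsBump T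
left-fromTop⇒bump {bump b} _ = b , refl

Dir-pigeonhole : ∀ (d₁ d₂ d₃ : Dir) → d₁ ≡ d₂ ⊎ d₁ ≡ d₃ ⊎ d₂ ≡ d₃
Dir-pigeonhole fromTop   fromTop   _         = inj₁ refl
Dir-pigeonhole fromRight fromRight _         = inj₁ refl
Dir-pigeonhole fromTop   fromRight fromTop   = inj₂ (inj₁ refl)
Dir-pigeonhole fromTop   fromRight fromRight = inj₂ (inj₂ refl)
Dir-pigeonhole fromRight fromTop   fromTop   = inj₂ (inj₂ refl)
Dir-pigeonhole fromRight fromTop   fromRight = inj₂ (inj₁ refl)

module _ {F : Filling} where

  Step-deterministic : Deterministic _≡_ (Step F)
  Step-deterministic (stepDown _) (stepDown _) = refl
  Step-deterministic (stepLeft _) (stepLeft _) = refl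
  Step-deterministic (stepDown p) (stepLeft q) with () ← trans (sym p) q
  Step-deterministic (stepLeft p) (stepDown q) with () ← trans (sym p) q

  Step-injective : Deterministic _≡_ (flip (Step F))
  Step-injective (stepDown p) (stepDown q) = cong (λ d → _ , _ , d) (move-injective _ p q)
  Step-injective (stepLeft p) (stepLeft q) = cong (λ d → _ , _ , d) (move-injective _ p q)

  Reach-forward-comparable : ∀ {s a b} → Reach F s a → Reach F s b → Reach F a b ⊎ Reach F b a
  Reach-forward-comparable = det⇒Star-comparable Step-deterministic

  Reach-backward-comparable : ∀ {a b z} → Reach F a z → Reach F b z → Reach F a b ⊎ Reach F b a
  Reach-backward-comparable = injective⇒Star-comparable Step-injective

  Reach-boundary : ∀ {i d s} → Reach F (i , 0 , d) s → s ≡ (i , 0 , d)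
  Reach-boundary ε = refl

  Step-monotone : ∀ {s w} → Step F s w → row s ≤ row w × col w ≤ col s
  Step-monotone (stepDown _) = n≤1+n _ , ≤-refl
  Step-monotone (stepLeft _) = ≤-refl , n≤1+n _

  Reach-monotone : ∀ {s w} → Reach F s w → row s ≤ row w × col w ≤ col s
  Reach-monotone ε = ≤-refl , ≤-refl
  Reach-monotone (x ◅ p) with Step-monotone x | Reach-monotone p
  ... | r₁ , c₁ | r₂ , c₂ = ≤-trans r₁ r₂ , ≤-trans c₂ c₁

  Reach-same-cell : ∀ {i k d d'} → Reach F (i , k , d) (i , k , d') → d ≡ d'
  Reach-same-cell ε = refl
  Reach-same-cell (stepDown _ ◅ p) = ⊥-elim (1+n≰n (proj₁ (Reach-monotone p)))
  Reach-same-cell (stepLeft _ ◅ p) = ⊥-elim (1+n≰n (proj₂ (Reach-monotone p)))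

  Reach-top-row : ∀ {a b} → Reach F (1 , a , fromTop) (1 , b , fromTop) → a ≡ b
  Reach-top-row p with Star-unsnoc p
  ... | inj₁ refl = refl
  ... | inj₂ (u , q , stepDown _) with () ← proj₁ (Reach-monotone q)

  Reach-fromRight-column : ∀ {u i k} → Reach F u (i , k , fromRight) → col u ≡ k →
                           u ≡ (i , k , fromRight)
  Reach-fromRight-column p refl with Star-unsnoc p
  ... | inj₁ eq = eq
  ... | inj₂ (u , q , stepLeft _) = ⊥-elim (1+n≰n (proj₂ (Reach-monotone q)))

  Reach-exit-unique : ∀ {s e e'} → Reach F s (e , 0 , fromRight) → Reach F s (e' , 0 , fromRight) → e ≡ e'
  Reach-exit-unique p q with Reach-forward-comparable p q
  ... | inj₁ r = cong proj₁ (sym (Reach-boundary r))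
  ... | inj₂ r = cong proj₁ (Reach-boundary r)

  Reach-same-source : ∀ {a b s} → Reach F (1 , a , fromTop) s → Reach F (1 , b , fromTop) s → a ≡ b
  Reach-same-source p q with Reach-backward-comparable p q
  ... | inj₁ r = Reach-top-row r
  ... | inj₂ r = sym (Reach-top-row r)

  Reach-three-pipes : ∀ {p₁ p₂ p₃ i k d₁ d₂ d₃} → p₁ ≢ p₂ → p₁ ≢ p₃ → p₂ ≢ p₃ →
    Reach F (1 , p₁ , fromTop) (i , k , d₁) → Reach F (1 , p₂ , fromTop) (i , k , d₂) →
    Reach F (1 , p₃ , fromTop) (i , k , d₃) → ⊥
  Reach-three-pipes {d₁ = d₁} {d₂} {d₃} p₁≢p₂ p₁≢p₃ p₂≢p₃ r₁ r₂ r₃ with Dir-pigeonhole d₁ d₂ d₃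
  ... | inj₁ refl        = p₁≢p₂ (Reach-same-source r₁ r₂)
  ... | inj₂ (inj₁ refl) = p₁≢p₃ (Reach-same-source r₁ r₃)
  ... | inj₂ (inj₂ refl) = p₂≢p₃ (Reach-same-source r₂ r₃)

  Reach-cell-direction : ∀ {s i k d d'} → Reach F s (i , k , d) → Reach F s (i , k , d') → d ≡ d'
  Reach-cell-direction p q with Reach-forward-comparable p q
  ... | inj₁ r = Reach-same-cell r
  ... | inj₂ r = sym (Reach-same-cell r)

  Reach-fromRight-below : ∀ {s i k k' d} → Reach F s (suc i , k , fromRight) → Reach F s (i , k' , d) → k < k'
  Reach-fromRight-below y z with Star-unsnoc y
  ... | inj₁ refl = ⊥-elim (1+n≰n (proj₁ (Reach-monotone z)))
  ... | inj₂ (_ , s→u , stepLeft _) with Reach-forward-comparable s→u z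
  ...   | inj₁ u→z = ⊥-elim (1+n≰n (proj₁ (Reach-monotone u→z)))
  ...   | inj₂ z→u = proj₂ (Reach-monotone z→u)

  Reach-fromTop-below : ∀ {s i k k' d} → Reach F s (suc i , k , fromTop) → Reach F s (i , k' , d) →
                        ∃ λ d₀ → Reach F (i , k' , d) (i , k , d₀)
  Reach-fromTop-below y z with Star-unsnoc y
  ... | inj₁ refl = ⊥-elim (1+n≰n (proj₁ (Reach-monotone z)))
  ... | inj₂ (_ , s→u , stepDown mv) with Reach-forward-comparable s→u z
  ...   | inj₂ z→u = _ , z→u
  ...   | inj₁ ε = _ , ε
  ...   | inj₁ (st ◅ rest) with refl ← Step-deterministic st (stepDown mv) =
          ⊥-elim (1+n≰n (proj₁ (Reach-monotone rest)))

  Reach-leaves-left : ∀ {i K w} → Reach F (i , K , fromRight) w → row w ≡ i → col w < K →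
                      move (F i K) fromRight ≡ left
  Reach-leaves-left ε _ w<K = ⊥-elim (<-irrefl refl w<K)
  Reach-leaves-left (stepDown _ ◅ p) refl _ = ⊥-elim (1+n≰n (proj₁ (Reach-monotone p)))
  Reach-leaves-left (stepLeft mv ◅ _) _ _ = mv

  Reach-along-row : ∀ {i k d w K} → Reach F (i , k , d) w → row w ≡ i → col w < K → K < k →
                    Reach F (i , k , d) (i , K , fromRight) × move (F i K) fromRight ≡ left
  Reach-along-row ε _ w<K K<k = ⊥-elim (<-asym w<K K<k)
  Reach-along-row (stepDown _ ◅ p) refl _ _ = ⊥-elim (1+n≰n (proj₁ (Reach-monotone p)))
  Reach-along-row {K = K} (stepLeft {k = k} mv ◅ p) w≡i w<K K<k with K ≟ k
  ... | yes refl = return (stepLeft mv) , Reach-leaves-left p w≡i w<K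
  ... | no K≢k with q , turns ← Reach-along-row p w≡i w<K (≤∧≢⇒< (≤-pred K<k) K≢k) = stepLeft mv ◅ q , turns

-- Walks inside the staircase

BumpsOnAntidiagonal : ℕ → Filling → Set
BumpsOnAntidiagonal m F = ∀ i k → 1 ≤ i → 1 ≤ k → i + k ≡ suc m → IsBump (F i k)

-- The third component makes the invariant inductive: an antidiagonal cell is a bump, which sends a pipe
-- entering it from the right out of the staircase.
InStaircase : ℕ → State → Set
InStaircase m (i , k , d) = 1 ≤ i × i + k ≤ suc m × (d ≡ fromRight → i + k ≤ m)

InStaircase⇒InStair : ∀ {m i k d} → InStaircase m (i , k , d) → 1 ≤ k → InStair m i k
InStaircase⇒InStair (i≥1 , bound , _) k≥1 = i≥1 , k≥1 , bound

module _ {m : ℕ} {F : Filling} (antidiag : BumpsOnAntidiagonal m F) where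

  Step-InStaircase : ∀ {s w} → Step F s w → InStaircase m s → InStaircase m w
  Step-InStaircase {i , suc k , fromRight} (stepDown _) (_ , _ , offDiagonal) =
    s≤s z≤n , s≤s (offDiagonal refl) , λ ()
  Step-InStaircase {i , suc k , fromTop} (stepDown mv) (i≥1 , bound , _) =
    s≤s z≤n , s≤s (≤-pred (≤∧≢⇒< bound notOnDiagonal)) , λ ()
    where
    notOnDiagonal : i + suc k ≢ suc m
    notOnDiagonal eq with () ← trans (sym mv) (bump-fromTop (antidiag i (suc k) i≥1 (s≤s z≤n) eq))
  Step-InStaircase {i , suc k , d} (stepLeft _) (i≥1 , bound , _) =
    i≥1 , ≤-trans (+-monoʳ-≤ i (n≤1+n k)) bound , λ _ → ≤-pred (subst (_≤ suc m) (+-suc i k) bound)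

  Reach-InStaircase : ∀ {s w} → Reach F s w → InStaircase m s → InStaircase m w
  Reach-InStaircase ε ok = ok
  Reach-InStaircase (x ◅ p) ok = Reach-InStaircase p (Step-InStaircase x ok)

  private
    fuel-exhausted : ∀ {i k} → i + suc k ≤ suc m → ¬ (m + suc k < i)
    fuel-exhausted {i} {k} bound lt = <-irrefl refl (begin-strict
      m + suc k  <⟨ lt ⟩
      i          ≤⟨ m≤m+n i k ⟩
      i + k      <⟨ ≤-reflexive (sym (+-suc i k)) ⟩
      i + suc k  ≤⟨ bound ⟩
      suc m      ≤⟨ m<m+n m (s≤s z≤n) ⟩
      m + suc k  ∎)
      where open ≤-Reasoning

    fuel-down : ∀ n i {k} → m + suc k < suc n + i → m + suc k < n + suc i
    fuel-down n i {k} = subst (m + suc k <_) (sym (+-suc n i))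

    fuel-left : ∀ n i {k} → m + suc (suc k) < suc n + i → m + suc k < n + i
    fuel-left n i {k} fuel = ≤-pred (subst (λ x → suc x ≤ suc n + i) (+-suc m (suc k)) fuel)

  -- The fuel bound m + k < n + i is preserved by every step and fails inside the staircase.
  path-complete : ∀ n {i k d w} → InStaircase m (i , suc k , d) → m + suc k < n + i →
                  Reach F (i , suc k , d) w → 1 ≤ col w → w ∈ path F n i (suc k) d
  path-complete zero ok fuel _ _ = ⊥-elim (fuel-exhausted (proj₁ (proj₂ ok)) fuel)
  path-complete (suc n) ok fuel ε _ = here refl
  path-complete (suc n) {i} {k} ok fuel (stepDown mv ◅ p) w≥1 rewrite mv =
    there (path-complete n (Step-InStaircase (stepDown mv) ok)
                           (fuel-down n i fuel) p w≥1)
  path-complete (suc n) {k = zero} ok fuel (stepLeft mv ◅ p) w≥1 with refl ← Reach-boundary p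
    with () ← w≥1
  path-complete (suc n) {i} {suc k} ok fuel (stepLeft mv ◅ p) w≥1 rewrite mv =
    there (path-complete n (Step-InStaircase (stepLeft mv) ok)
                           (fuel-left n i fuel) p w≥1)

  exit-complete : ∀ n {i k d e} → InStaircase m (i , suc k , d) → m + suc k < n + i →
                  Reach F (i , suc k , d) (e , 0 , fromRight) → exit F n i (suc k) d ≡ just e
  exit-complete zero ok fuel _ = ⊥-elim (fuel-exhausted (proj₁ (proj₂ ok)) fuel)
  exit-complete (suc n) {i} {k} ok fuel (stepDown mv ◅ p) rewrite mv =
    exit-complete n (Step-InStaircase (stepDown mv) ok) (fuel-down n i fuel) p
  exit-complete (suc n) {k = zero} ok fuel (stepLeft mv ◅ p) rewrite mv with refl ← Reach-boundary p = refl
  exit-complete (suc n) {i} {suc k} ok fuel (stepLeft mv ◅ p) rewrite mv =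
    exit-complete n (Step-InStaircase (stepLeft mv) ok)
                    (fuel-left n i fuel) p

  path-firstRowIn : ∀ n {i b d r k} → InStaircase m (i , suc b , d) → m + suc b < n + i →
                    Reach F (i , suc b , d) (r , k , fromRight) → 1 ≤ k →
                    firstRowIn k (path F n i (suc b) d) ≡ r
  path-firstRowIn zero ok fuel _ _ = ⊥-elim (fuel-exhausted (proj₁ (proj₂ ok)) fuel)
  path-firstRowIn (suc n) {i} {b} {k = k} ok fuel p k≥1 with suc b ≟ k
  ... | yes refl = cong row (Reach-fromRight-column p refl)
  ... | no b≢k with p
  ...   | ε = ⊥-elim (b≢k refl)
  ...   | stepDown mv ◅ q rewrite mv =
          path-firstRowIn n (Step-InStaircase (stepDown mv) ok) (fuel-down n i fuel) q k≥1
  path-firstRowIn (suc n) {b = zero} ok fuel p k≥1 | no _ | stepLeft mv ◅ q with refl ← Reach-boundary q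
    with () ← k≥1
  path-firstRowIn (suc n) {i} {suc b} ok fuel p k≥1 | no _ | stepLeft mv ◅ q rewrite mv =
    path-firstRowIn n (Step-InStaircase (stepLeft mv) ok)
                      (fuel-left n i fuel) q k≥1

module _ {F : Filling} where

  path-sound : ∀ n {i k d w} → w ∈ path F n i (suc k) d → Reach F (i , suc k , d) w
  path-sound (suc n) (here refl) = ε
  path-sound (suc n) {i} {k} {d} (there w∈) with move (F i (suc k)) d in mv
  ... | down = stepDown mv ◅ path-sound n w∈
  path-sound (suc n) {i} {suc k} {d} (there w∈) | left = stepLeft mv ◅ path-sound n w∈

  exit-sound : ∀ n {i k d e} → exit F n i (suc k) d ≡ just e → Reach F (i , suc k , d) (e , 0 , fromRight)
  exit-sound (suc n) {i} {k} {d} ex with move (F i (suc k)) d in mv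
  ... | down = stepDown mv ◅ exit-sound n ex
  exit-sound (suc n) {i} {zero} {d} refl | left = stepLeft mv ◅ ε
  exit-sound (suc n) {i} {suc k} {d} ex | left = stepLeft mv ◅ exit-sound n ex

  Enters⇒Reach : ∀ {m k i c d} → Enters F m (suc k) i c d → Reach F (1 , suc k , fromTop) (i , c , d)
  Enters⇒Reach {m} = path-sound (fuel m)

  pipeExit⇒Reach : ∀ {m k e} → pipeExit F m (suc k) ≡ just e → Reach F (1 , suc k , fromTop) (e , 0 , fromRight)
  pipeExit⇒Reach {m} = exit-sound (fuel m)

module _ {m : ℕ} {F : Filling} (antidiag : BumpsOnAntidiagonal m F) {k : ℕ} (k<m : k < m) where

  private
    start : InStaircase m (1 , suc k , fromTop)
    start = s≤s z≤n , s≤s k<m , λ ()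

    enough-fuel : m + suc k < fuel m + 1
    enough-fuel = begin-strict
      m + suc k   ≤⟨ +-monoʳ-≤ m k<m ⟩
      m + m       <⟨ n<1+n (m + m) ⟩
      fuel m      ≤⟨ m≤m+n (fuel m) 1 ⟩
      fuel m + 1  ∎
      where open ≤-Reasoning

  pipe-InStaircase : ∀ {s} → Reach F (1 , suc k , fromTop) s → InStaircase m s
  pipe-InStaircase p = Reach-InStaircase antidiag p start

  Reach⇒Enters : ∀ {i c d} → Reach F (1 , suc k , fromTop) (i , c , d) → 1 ≤ c → Enters F m (suc k) i c d
  Reach⇒Enters p c≥1 = path-complete antidiag (fuel m) start enough-fuel p c≥1

  Reach⇒pipeExit : ∀ {e} → Reach F (1 , suc k , fromTop) (e , 0 , fromRight) → pipeExit F m (suc k) ≡ just e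
  Reach⇒pipeExit = exit-complete antidiag (fuel m) start enough-fuel

  Reach⇒firstRowIn : ∀ {r k'} → Reach F (1 , suc k , fromTop) (r , k' , fromRight) → 1 ≤ k' →
                     firstRowIn k' (pipePath F m (suc k)) ≡ r
  Reach⇒firstRowIn = path-firstRowIn antidiag (fuel m) start enough-fuel

-- Ranks and deletion of an entry

rank-∷-< : ∀ {a w x} → a < x → rank (a ∷ w) x ≡ suc (rank w x)
rank-∷-< {x = x} a<x = cong length (filter-accept (_<? x) a<x)

rank-∷-≮ : ∀ {a w x} → ¬ a < x → rank (a ∷ w) x ≡ rank w x
rank-∷-≮ {x = x} a≮x = cong length (filter-reject (_<? x) a≮x)

rank-mono : ∀ v {x y} → x ≤ y → rank v x ≤ rank v y
rank-mono [] x≤y = z≤n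
rank-mono (a ∷ w) {x} {y} x≤y with a <? x | a <? y
... | yes a<x | yes a<y rewrite rank-∷-< {w = w} a<x | rank-∷-< {w = w} a<y = s≤s (rank-mono w x≤y)
... | yes a<x | no  a≮y = ⊥-elim (a≮y (<-≤-trans a<x x≤y))
... | no  a≮x | yes a<y rewrite rank-∷-≮ {w = w} a≮x | rank-∷-< {w = w} a<y = m≤n⇒m≤1+n (rank-mono w x≤y)
... | no  a≮x | no  a≮y rewrite rank-∷-≮ {w = w} a≮x | rank-∷-≮ {w = w} a≮y = rank-mono w x≤y

rank-strict : ∀ v {x y} → x < y → x ∈ v → rank v x < rank v y
rank-strict (a ∷ w) {x} {y} x<y (here refl)
  rewrite rank-∷-≮ {x} {w} {x} (<-irrefl refl) | rank-∷-< {w = w} x<y = s≤s (rank-mono w (<⇒≤ x<y))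
rank-strict (a ∷ w) {x} {y} x<y (there x∈w) with a <? x | a <? y
... | yes a<x | yes a<y rewrite rank-∷-< {w = w} a<x | rank-∷-< {w = w} a<y = s≤s (rank-strict w x<y x∈w)
... | yes a<x | no  a≮y = ⊥-elim (a≮y (<-trans a<x x<y))
... | no  a≮x | yes a<y rewrite rank-∷-≮ {w = w} a≮x | rank-∷-< {w = w} a<y = m<n⇒m<1+n (rank-strict w x<y x∈w)
... | no  a≮x | no  a≮y rewrite rank-∷-≮ {w = w} a≮x | rank-∷-≮ {w = w} a≮y = rank-strict w x<y x∈w

rank-injective : ∀ v {x y} → x ∈ v → y ∈ v → rank v x ≡ rank v y → x ≡ y
rank-injective v {x} {y} x∈v y∈v eq with <-cmp x y
... | tri< x<y _ _ = ⊥-elim (<-irrefl eq (rank-strict v x<y x∈v))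
... | tri≈ _ x≡y _ = x≡y
... | tri> _ _ y<x = ⊥-elim (<-irrefl (sym eq) (rank-strict v y<x y∈v))

rank<length : ∀ v {x} → x ∈ v → rank v x < length v
rank<length v x∈v = filter-notAll (_<? _) v (Any.map (λ { refl → <-irrefl refl }) x∈v)

module _ {j : ℕ} where

  private
    del? : ∀ x → Dec (x ≢ j)
    del? x = ¬? (x ≟ j)

  deleteEntry-∷-≡ : ∀ {w} → deleteEntry j (j ∷ w) ≡ deleteEntry j w
  deleteEntry-∷-≡ = filter-reject del? (λ j≢j → j≢j refl)

  deleteEntry-∷-≢ : ∀ {a w} → a ≢ j → deleteEntry j (a ∷ w) ≡ a ∷ deleteEntry j w
  deleteEntry-∷-≢ = filter-accept del?

  deleteEntry-∉ : ∀ {w} → All.All (j ≢_) w → deleteEntry j w ≡ w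
  deleteEntry-∉ j∉w = filter-all del? (All.map ≢-sym j∉w)

  private
    delete-head : ∀ {w} → All.All (j ≢_) w → deleteEntry j (j ∷ w) ≡ w
    delete-head j∉w = trans deleteEntry-∷-≡ (deleteEntry-∉ j∉w)

  length-deleteEntry : ∀ v → Unique v → j ∈ v → length v ≡ suc (length (deleteEntry j v))
  length-deleteEntry (a ∷ w) (a∉w ∷ uw) j∈v with a ≟ j | j∈v
  ... | yes refl | _         = cong (suc ∘ length) (sym (delete-head a∉w))
  ... | no  a≢j  | here refl = ⊥-elim (a≢j refl)
  ... | no  a≢j  | there j∈w rewrite deleteEntry-∷-≢ {w = w} a≢j = cong suc (length-deleteEntry w uw j∈w)

  rank-deleteEntry-≮ : ∀ v {x} → ¬ j < x → rank (deleteEntry j v) x ≡ rank v x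
  rank-deleteEntry-≮ [] _ = refl
  rank-deleteEntry-≮ (a ∷ w) {x} j≮x with a ≟ j
  ... | yes refl rewrite deleteEntry-∷-≡ {w} | rank-∷-≮ {w = w} j≮x = rank-deleteEntry-≮ w j≮x
  ... | no  a≢j  rewrite deleteEntry-∷-≢ {w = w} a≢j with a <? x
  ...   | yes a<x rewrite rank-∷-< {w = w} a<x | rank-∷-< {w = deleteEntry j w} a<x =
          cong suc (rank-deleteEntry-≮ w j≮x)
  ...   | no  a≮x rewrite rank-∷-≮ {w = w} a≮x | rank-∷-≮ {w = deleteEntry j w} a≮x =
          rank-deleteEntry-≮ w j≮x

  rank-deleteEntry-< : ∀ v → Unique v → j ∈ v → ∀ {x} → j < x → rank v x ≡ suc (rank (deleteEntry j v) x)
  rank-deleteEntry-< (a ∷ w) (a∉w ∷ uw) j∈v {x} j<x with a ≟ j | j∈v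
  ... | yes refl | _ rewrite delete-head a∉w = rank-∷-< j<x
  ... | no  a≢j  | here refl = ⊥-elim (a≢j refl)
  ... | no  a≢j  | there j∈w rewrite deleteEntry-∷-≢ {w = w} a≢j with a <? x
  ...   | yes a<x rewrite rank-∷-< {w = w} a<x | rank-∷-< {w = deleteEntry j w} a<x =
          cong suc (rank-deleteEntry-< w uw j∈w j<x)
  ...   | no  a≮x rewrite rank-∷-≮ {w = w} a≮x | rank-∷-≮ {w = deleteEntry j w} a≮x =
          rank-deleteEntry-< w uw j∈w j<x

  lookup-deleteEntry : ∀ v → Unique v → (q e : Fin (length v)) → lookup v q ≡ j → toℕ e ≢ toℕ q →
    ∃ λ r → lookup (deleteEntry j v) r ≡ lookup v e ×
            (toℕ e < toℕ q → toℕ r ≡ toℕ e) × (toℕ q < toℕ e → suc (toℕ r) ≡ toℕ e)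
  lookup-deleteEntry (a ∷ w) (a∉w ∷ uw) q e vq≡j e≢q with a ≟ j
  lookup-deleteEntry (a ∷ w) (a∉w ∷ uw) fzero fzero _ e≢q | yes refl = ⊥-elim (e≢q refl)
  lookup-deleteEntry (a ∷ w) (a∉w ∷ uw) fzero (fsuc e) _ _ | yes refl
    rewrite delete-head a∉w = e , refl , (λ ()) , (λ _ → refl)
  lookup-deleteEntry (a ∷ w) (a∉w ∷ uw) (fsuc q) _ vq≡j _ | yes refl =
    ⊥-elim (All.lookup a∉w (∈-lookup q) (sym vq≡j))
  lookup-deleteEntry (a ∷ w) _ fzero _ vq≡j _ | no a≢j = ⊥-elim (a≢j vq≡j)
  lookup-deleteEntry (a ∷ w) _ (fsuc q) fzero _ _ | no a≢j
    rewrite deleteEntry-∷-≢ {w = w} a≢j = fzero , refl , (λ _ → refl) , (λ ())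
  lookup-deleteEntry (a ∷ w) (_ ∷ uw) (fsuc q) (fsuc e) vq≡j e≢q | no a≢j
    rewrite deleteEntry-∷-≢ {w = w} a≢j
    with lookup-deleteEntry w uw q e vq≡j (e≢q ∘ cong suc)
  ... | r , same , before , after = fsuc r , same , cong suc ∘ before ∘ ≤-pred , cong suc ∘ after ∘ ≤-pred

-- Removing a pipe

module _ {v : List ℕ} {j : ℕ} {F : Filling} {i k : ℕ} where

  Φ-right : colOf v j ≤ k → Φ v j F i k ≡ F i (suc k)
  Φ-right c≤k with k <? colOf v j
  ... | yes k<c = ⊥-elim (<-irrefl refl (<-≤-trans k<c c≤k))
  ... | no _ = refl

  Φ-left : k < colOf v j → Φ v j F i k ≡ leftCol F (rowIn v j F k) i k
  Φ-left k<c with k <? colOf v j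
  ... | yes _ = refl
  ... | no k≮c = ⊥-elim (k≮c k<c)

module _ {F : Filling} {r i k : ℕ} where

  leftCol-above : i < r → leftCol F r i k ≡ F i k
  leftCol-above i<r with i <? r
  ... | yes _ = refl
  ... | no i≮r = ⊥-elim (i≮r i<r)

  leftCol-cross : r ≤ i → F r k ≡ cross → leftCol F r i k ≡ F (suc i) k
  leftCol-cross r≤i Frk with i <? r
  ... | yes i<r = ⊥-elim (<-irrefl refl (<-≤-trans i<r r≤i))
  ... | no _ rewrite Frk = refl

  leftCol-bump-below : ∀ {b} → r < i → F r k ≡ bump b → leftCol F r i k ≡ F (suc i) k
  leftCol-bump-below r<i Frk with i <? r
  ... | yes i<r = ⊥-elim (<-asym i<r r<i)
  ... | no _ rewrite Frk with i ≟ r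
  ...   | yes refl = ⊥-elim (<-irrefl refl r<i)
  ...   | no _ = refl

leftCol-merged : ∀ {F r k b} → F r k ≡ bump b → leftCol F r r k ≡ bump false
leftCol-merged {r = r} Frk with r <? r
... | yes r<r = ⊥-elim (<-irrefl refl r<r)
... | no _ rewrite Frk with r ≟ r
...   | yes _ = refl
...   | no r≢r = ⊥-elim (r≢r refl)

-- The row in which a pipe entering tile T of row r from the right leaves its column (through the tile below,
-- for a bump).
rowLeaving : Tile → ℕ → ℕ
rowLeaving cross    r = r
rowLeaving (bump _) r = suc r

rowLeaving-≥ : ∀ T r → r ≤ rowLeaving T r
rowLeaving-≥ cross    r = ≤-refl
rowLeaving-≥ (bump _) r = n≤1+n r

MarkJustified : Filling → ℕ → ℕ → ℕ → Set
MarkJustified F m i c = ∃ λ k₁ → ∃ λ k₂ → IsPipe m k₁ × IsPipe m k₂ ×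
  Enters F m k₁ i c fromTop × Enters F m k₂ i c fromRight ×
  ∃ λ i' → ∃ λ c' → i' < i × InStair m i' c' × F i' c' ≡ cross × Visits F m k₁ i' c' × Visits F m k₂ i' c'

module PipeRemoval (v : List ℕ) (v-unique : Unique v) (P : Filling) (dream : MarkedReducedPipeDream v P)
                   (j : ℕ) (j∈v : j ∈ v) (removable : Removable v j P) where

  open MarkedReducedPipeDream dream using (antidiagonal; reading; reduced; marks)
  open Removable removable using (column; above; noMarked)

  m c₀ c t : ℕ
  m = length v
  c₀ = rank v j
  c = colOf v j
  t = proj₁ column

  column-crosses : ∀ {i} → 1 ≤ i → i ≤ t → P i c ≡ cross
  column-crosses i≥1 i≤t = proj₁ (proj₁ (proj₂ column) _ i≥1 i≤t)

  column-bumps : ∀ {i} → t < i → i + c ≤ suc m → P i c ≡ bump false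
  column-bumps = proj₂ (proj₂ column) _

  c₀<m : c₀ < m
  c₀<m = rank<length v j∈v

  OnPipeJ : State → Set
  OnPipeJ = Reach P (1 , c , fromTop)

  j-InStaircase : ∀ {s} → OnPipeJ s → InStaircase m s
  j-InStaircase = pipe-InStaircase antidiagonal c₀<m

  j-visits : ∀ {i k d} → OnPipeJ (i , suc k , d) → Visits P m c i (suc k)
  j-visits {d = d} p = d , Reach⇒Enters antidiagonal c₀<m p (s≤s z≤n)

  j-InStair : ∀ {i k d} → OnPipeJ (i , suc k , d) → InStair m i (suc k)
  j-InStair p = InStaircase⇒InStair (j-InStaircase p) (s≤s z≤n)

  j-descends : ∀ i → i ≤ t → OnPipeJ (suc i , c , fromTop)
  j-descends zero    _   = ε
  j-descends (suc i) i<t = j-descends i (<⇒≤ i<t) ◅◅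
    return (stepDown (cong (λ T → move T fromTop) (column-crosses (s≤s z≤n) i<t)))

  t+c≤m : t + c ≤ m
  t+c≤m = ≤-pred (proj₁ (proj₂ (j-InStaircase (j-descends t ≤-refl))))

  j-turns : OnPipeJ (suc t , c₀ , fromRight)
  j-turns = j-descends t ≤-refl ◅◅
    return (stepLeft (cong (λ T → move T fromTop) (column-bumps ≤-refl (s≤s t+c≤m))))

  j-bump-pair : ∀ {r k} → OnPipeJ (r , suc k , fromRight) → IsBump (P r (suc k)) →
    P r (suc k) ≡ bump false × P (suc r) (suc k) ≡ bump false × OnPipeJ (suc r , suc k , fromTop)
  j-bump-pair {r} {k} p (b , upper) = upper-unmarked b upper , lower-unmarked , p↓
    where
    p↓ : OnPipeJ (suc r , suc k , fromTop)
    p↓ = p ◅◅ return (stepDown (cong (λ T → move T fromRight) upper))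

    upper-unmarked : ∀ b → P r (suc k) ≡ bump b → P r (suc k) ≡ bump false
    upper-unmarked true  marked = ⊥-elim (noMarked _ _ (j-InStair p) (j-visits p) marked)
    upper-unmarked false eq     = eq

    lower-unmarked : P (suc r) (suc k) ≡ bump false
    lower-unmarked with P (suc r) (suc k) in lower
    ... | cross      = ⊥-elim (above r (suc k) (j-InStair p↓) lower (j-visits p↓) (upper-unmarked b upper))
    ... | bump true  = ⊥-elim (noMarked _ _ (j-InStair p↓) (j-visits p↓) lower)
    ... | bump false = refl

  j-leaves-column : ∀ {r k} → OnPipeJ (r , suc k , fromRight) →
                    OnPipeJ (rowLeaving (P r (suc k)) r , k , fromRight)
  j-leaves-column {r} {k} p with P r (suc k) in tile
  ... | cross  = p ◅◅ return (stepLeft (cong (λ T → move T fromRight) tile))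
  ... | bump b with j-bump-pair p (b , tile)
  ...   | _ , lower , p↓ = p↓ ◅◅ return (stepLeft (cong (λ T → move T fromTop) lower))

  j-row-unique : ∀ {a b k} → OnPipeJ (a , k , fromRight) → OnPipeJ (b , k , fromRight) → a ≡ b
  j-row-unique p q with Reach-forward-comparable p q
  ... | inj₁ r = cong row (Reach-fromRight-column r refl)
  ... | inj₂ r = sym (cong row (Reach-fromRight-column r refl))

  -- rowFrom n is the row at which pipe j enters column c₀ ∸ n from the right.
  rowFrom : ℕ → ℕ
  rowFrom zero    = suc t
  rowFrom (suc n) = rowLeaving (P (rowFrom n) (c₀ ∸ n)) (rowFrom n)

  j-enters-rowFrom : ∀ n → n ≤ c₀ → OnPipeJ (rowFrom n , c₀ ∸ n , fromRight)
  j-enters-rowFrom zero    _    = j-turns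
  j-enters-rowFrom (suc n) n<c₀ with c₀ ∸ n | +-∸-assoc 1 n<c₀ | j-enters-rowFrom n (<⇒≤ n<c₀)
  ... | _ | refl | p = j-leaves-column p

  jRow : ℕ → ℕ
  jRow k = rowFrom (c₀ ∸ k)

  j-enters : ∀ {k} → k ≤ c₀ → OnPipeJ (jRow k , k , fromRight)
  j-enters {k} k≤c₀ = subst (λ x → OnPipeJ (jRow k , x , fromRight)) (m∸[m∸n]≡n k≤c₀)
                            (j-enters-rowFrom (c₀ ∸ k) (m∸n≤m c₀ k))

  jRow-c₀ : jRow c₀ ≡ suc t
  jRow-c₀ = j-row-unique (j-enters ≤-refl) j-turns

  jRow-step : ∀ {k} → suc k ≤ c₀ → jRow k ≡ rowLeaving (P (jRow (suc k)) (suc k)) (jRow (suc k))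
  jRow-step k<c₀ = j-row-unique (j-enters (<⇒≤ k<c₀)) (j-leaves-column (j-enters k<c₀))

  jRow-antitone : ∀ {k k'} → k ≤ k' → k' ≤ c₀ → jRow k' ≤ jRow k
  jRow-antitone {k' = zero} z≤n _ = ≤-refl
  jRow-antitone {k} {suc k'} k≤k' k'<c₀ with k ≟ suc k'
  ... | yes refl = ≤-refl
  ... | no k≢k' = ≤-trans (subst (jRow (suc k') ≤_) (sym (jRow-step k'<c₀)) (rowLeaving-≥ _ _))
                          (jRow-antitone (≤-pred (≤∧≢⇒< k≤k' k≢k')) (<⇒≤ k'<c₀))

  jRow≥1 : ∀ {k} → k ≤ c₀ → 1 ≤ jRow k
  jRow≥1 k≤c₀ = proj₁ (j-InStaircase (j-enters k≤c₀))

  jRow+k≤m : ∀ {k} → k ≤ c₀ → jRow k + k ≤ m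
  jRow+k≤m k≤c₀ = proj₂ (proj₂ (j-InStaircase (j-enters k≤c₀))) refl

  jRow-bump-pair : ∀ {k} → 1 ≤ k → k < c → IsBump (P (jRow k) k) →
    P (jRow k) k ≡ bump false × P (suc (jRow k)) k ≡ bump false × OnPipeJ (suc (jRow k) , k , fromTop)
  jRow-bump-pair {suc k} _ k<c = j-bump-pair (j-enters (≤-pred k<c))

  ΦP : Filling
  ΦP = Φ v j P

  Φ-leftOf : ∀ {i k} → 1 ≤ k → k < c → ΦP i k ≡ leftCol P (jRow k) i k
  Φ-leftOf {i} {k} k≥1 k<c =
    trans (Φ-left {v} {j} {P} k<c) (cong (λ r → leftCol P r i k) (rowIn≡jRow k≥1 (≤-pred k<c)))
    where
    rowIn≡jRow : ∀ {k} → 1 ≤ k → k ≤ c₀ → rowIn v j P k ≡ jRow k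
    rowIn≡jRow k≥1 k≤c₀ = Reach⇒firstRowIn antidiagonal c₀<m (j-enters k≤c₀) k≥1

  -- The cell of P whose tile Φ places at (i , k).
  origin : ℕ → ℕ → ℕ × ℕ
  origin i k with k <? c | i <? jRow k
  ... | yes _ | yes _ = i , k
  ... | yes _ | no _  = suc i , k
  ... | no _  | _     = i , suc k

  module _ {i k : ℕ} where

    origin-above : k < c → i < jRow k → origin i k ≡ (i , k)
    origin-above k<c i<r with k <? c | i <? jRow k
    ... | yes _ | yes _ = refl
    ... | yes _ | no i≮r = ⊥-elim (i≮r i<r)
    ... | no k≮c | _ = ⊥-elim (k≮c k<c)

    origin-below : k < c → jRow k ≤ i → origin i k ≡ (suc i , k)
    origin-below k<c r≤i with k <? c | i <? jRow k
    ... | yes _ | yes i<r = ⊥-elim (<-irrefl refl (<-≤-trans i<r r≤i))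
    ... | yes _ | no _ = refl
    ... | no k≮c | _ = ⊥-elim (k≮c k<c)

    origin-right : c ≤ k → origin i k ≡ (i , suc k)
    origin-right c≤k with k <? c
    ... | yes k<c = ⊥-elim (<-irrefl refl (<-≤-trans k<c c≤k))
    ... | no _ = refl

  -- This holds also at a merged cell (r_k , k), where both tiles are unmarked bumps.
  Φ-origin : ∀ i k → 1 ≤ k → ΦP i k ≡ uncurry P (origin i k)
  Φ-origin i k k≥1 with <-cmp k c
  ... | tri> _ _ c<k rewrite origin-right {i} (<⇒≤ c<k) = Φ-right {v} {j} {P} (<⇒≤ c<k)
  ... | tri≈ _ refl _ rewrite origin-right {i} ≤-refl = Φ-right {v} {j} {P} ≤-refl
  ... | tri< k<c _ _ with <-cmp i (jRow k)
  ...   | tri< i<r _ _ rewrite origin-above k<c i<r = trans (Φ-leftOf k≥1 k<c) (leftCol-above {P} i<r)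
  ...   | tri≈ _ refl _ rewrite origin-below k<c (≤-reflexive refl) = trans (Φ-leftOf k≥1 k<c) (at-jRow (P i k) refl)
    where
    at-jRow : ∀ T → P i k ≡ T → leftCol P i i k ≡ P (suc i) k
    at-jRow cross    tile = leftCol-cross {P} ≤-refl tile
    at-jRow (bump b) tile = trans (leftCol-merged {P} tile) (sym (proj₁ (proj₂ (jRow-bump-pair k≥1 k<c (b , tile)))))
  ...   | tri> _ _ r<i rewrite origin-below k<c (<⇒≤ r<i) = trans (Φ-leftOf k≥1 k<c) (below-jRow (P (jRow k) k) refl)
    where
    below-jRow : ∀ T → P (jRow k) k ≡ T → leftCol P (jRow k) i k ≡ P (suc i) k
    below-jRow cross    tile = leftCol-cross {P} (<⇒≤ r<i) tile
    below-jRow (bump _) tile = leftCol-bump-below {P} r<i tile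

  Φ-above : ∀ {i k} → 1 ≤ k → k < c → i < jRow k → ΦP i k ≡ P i k
  Φ-above {i} {k} k≥1 k<c i<r = trans (Φ-origin i k k≥1) (cong (uncurry P) (origin-above k<c i<r))

  Φ-below : ∀ {i k} → 1 ≤ k → k < c → jRow k ≤ i → ΦP i k ≡ P (suc i) k
  Φ-below {i} {k} k≥1 k<c r≤i = trans (Φ-origin i k k≥1) (cong (uncurry P) (origin-below k<c r≤i))

  -- A state in column c is sent to the image of the state in which its pipe leaves column c.
  collapseColumn : ℕ → Dir → State
  collapseColumn i fromRight = i , c₀ , fromRight
  collapseColumn i fromTop   = pred i , c₀ , fromRight

  collapse : State → State
  collapse (i , k , d) with <-cmp k c | i ≤? jRow k
  ... | tri< _ _ _ | yes _ = i , k , d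
  ... | tri< _ _ _ | no _  = pred i , k , d
  ... | tri≈ _ _ _ | _     = collapseColumn i d
  ... | tri> _ _ _ | _     = i , pred k , d

  module _ {i k : ℕ} {d : Dir} where

    collapse-above : k < c → i ≤ jRow k → collapse (i , k , d) ≡ (i , k , d)
    collapse-above k<c i≤r with <-cmp k c | i ≤? jRow k
    ... | tri< _ _ _ | yes _ = refl
    ... | tri< _ _ _ | no i≰r = ⊥-elim (i≰r i≤r)
    ... | tri≈ k≮c _ _ | _ = ⊥-elim (k≮c k<c)
    ... | tri> k≮c _ _ | _ = ⊥-elim (k≮c k<c)

    collapse-below : k < c → jRow k < i → collapse (i , k , d) ≡ (pred i , k , d)
    collapse-below k<c r<i with <-cmp k c | i ≤? jRow k
    ... | tri< _ _ _ | yes i≤r = ⊥-elim (<-irrefl refl (<-≤-trans r<i i≤r))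
    ... | tri< _ _ _ | no _ = refl
    ... | tri≈ k≮c _ _ | _ = ⊥-elim (k≮c k<c)
    ... | tri> k≮c _ _ | _ = ⊥-elim (k≮c k<c)

    collapse-right : c < k → collapse (i , k , d) ≡ (i , pred k , d)
    collapse-right c<k with <-cmp k c | i ≤? jRow k
    ... | tri< _ _ k≯c | _ = ⊥-elim (k≯c c<k)
    ... | tri≈ _ _ k≯c | _ = ⊥-elim (k≯c c<k)
    ... | tri> _ _ _ | _ = refl

  collapse-column : ∀ {i d} → collapse (i , c , d) ≡ collapseColumn i d
  collapse-column {i} with <-cmp c c | i ≤? jRow c
  ... | tri< c<c _ _ | _ = ⊥-elim (<-irrefl refl c<c)
  ... | tri≈ _ _ _ | _ = refl
  ... | tri> _ _ c>c | _ = ⊥-elim (<-irrefl refl c>c)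

  collapse-fromRight : ∀ {i k} → c ≤ k → collapse (i , k , fromRight) ≡ (i , pred k , fromRight)
  collapse-fromRight c≤k with m≤n⇒m<n∨m≡n c≤k
  ... | inj₁ c<k = collapse-right c<k
  ... | inj₂ refl = collapse-column

  -- The states whose steps are invisible in Φ P: column c, and the crossings of pipe j left of c.
  Erased : State → Set
  Erased (i , k , d) = k ≡ c ⊎ (1 ≤ k × k < c × i ≡ jRow k × P i k ≡ cross)

  ¬Erased : ∀ {i k d} → k ≢ c → (k < c → i ≡ jRow k → P i k ≢ cross) → ¬ Erased (i , k , d)
  ¬Erased k≢c _   (inj₁ k≡c)                    = k≢c k≡c
  ¬Erased _   off (inj₂ (_ , k<c , i≡r , is-cross)) = off k<c i≡r is-cross

  j-column : ∀ {i} → 1 ≤ i → i ≤ suc t → OnPipeJ (i , c , fromTop)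
  j-column {suc i} _ i≤t = j-descends i (≤-pred i≤t)

  column-below-t : ∀ {i d} → InStaircase m (i , c , d) → ¬ i ≤ t → P i c ≡ bump false
  column-below-t (_ , bound , _) i≰t = column-bumps (≰⇒> i≰t) bound

  step-right : ∀ {i k d y'} → c < k → Step P (i , k , d) y' → Step ΦP (collapse (i , k , d)) (collapse y')
  step-right {k = suc zero} (s≤s ()) _
  step-right {i} {suc (suc k)} {d} c<k (stepDown mv)
    rewrite collapse-right {i} {d = d} c<k | collapse-right {suc i} {d = fromTop} c<k =
    stepDown (retile (Φ-right {v} {j} {P} (≤-pred c<k)) mv)
  step-right {i} {suc (suc k)} {d} c<k (stepLeft mv)
    rewrite collapse-right {i} {d = d} c<k | collapse-fromRight {i} (≤-pred c<k) =
    stepLeft (retile (Φ-right {v} {j} {P} (≤-pred c<k)) mv)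

  step-column : ∀ {i d y'} → InStaircase m (i , c , d) → ¬ OnPipeJ (i , c , d) → Step P (i , c , d) y' →
                collapse y' ≡ collapse (i , c , d)
  step-column {i} {fromRight} ok notJ (stepDown mv) = trans collapse-column (sym collapse-column)
  step-column {i} {fromRight} ok notJ (stepLeft mv) =
    trans (collapse-above (n<1+n c₀) (subst (i ≤_) (sym jRow-c₀) (m≤n⇒m≤1+n i≤t))) (sym collapse-column)
    where
    i≤t : i ≤ t
    i≤t with i ≤? t
    ... | yes i≤t = i≤t
    ... | no i≰t with () ← trans (sym (retile (column-below-t ok i≰t) refl)) mv
  step-column {i} {fromTop} ok notJ (stepDown mv) with i ≤? t
  ... | yes i≤t = ⊥-elim (notJ (j-column (proj₁ ok) (m≤n⇒m≤1+n i≤t)))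
  ... | no i≰t with () ← trans (sym (column-below-t ok i≰t)) (down-fromTop⇒cross mv)
  step-column {i} {fromTop} ok notJ (stepLeft mv) with i ≤? suc t
  ... | yes i≤t = ⊥-elim (notJ (j-column (proj₁ ok) i≤t))
  ... | no i≰t = trans (collapse-below (n<1+n c₀) (subst (_< i) (sym jRow-c₀) (≰⇒> i≰t))) (sym collapse-column)

  step-above : ∀ {i k d y'} → k < c → i < jRow k → Step P (i , k , d) y' →
               Step ΦP (collapse (i , k , d)) (collapse y')
  step-above {i} {suc k} {d} k<c i<r (stepDown mv)
    rewrite collapse-above {i} {d = d} k<c (<⇒≤ i<r) | collapse-above {suc i} {d = fromTop} k<c i<r =
    stepDown (retile (Φ-above (s≤s z≤n) k<c i<r) mv)
  step-above {i} {suc k} {d} k<c i<r (stepLeft mv)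
    rewrite collapse-above {i} {d = d} k<c (<⇒≤ i<r)
          | collapse-above {i} {d = fromRight} (<-trans (n<1+n k) k<c)
                           (≤-trans (<⇒≤ i<r) (jRow-antitone (n≤1+n k) (≤-pred k<c))) =
    stepLeft (retile (Φ-above (s≤s z≤n) k<c i<r) mv)

  -- Below a bump pair of pipe j, leaving (r_{k+1} + 1 , k + 1) to the left needs the lower bump entered
  -- from the top, which is pipe j itself.
  leaving-below-jRow : ∀ {i k d} → suc k < c → jRow (suc k) < suc i → ¬ OnPipeJ (suc i , suc k , d) →
                       move (P (suc i) (suc k)) d ≡ left → jRow k < suc i
  leaving-below-jRow {i} {k} k<c r<i notJ mv with P (jRow (suc k)) (suc k) in tile | jRow-step {k} (≤-pred k<c)
  ... | cross  | r'≡r = subst (_< suc i) (sym r'≡r) r<i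
  ... | bump b | r'≡r with m≤n⇒m<n∨m≡n (≤-pred r<i)
  ...   | inj₁ r<i' = subst (_< suc i) (sym r'≡r) (s≤s r<i')
  ...   | inj₂ refl with jRow-bump-pair (s≤s z≤n) k<c (b , tile)
  ...     | _ , lower , onJ with refl ← move-injective (bump false) {d' = fromTop} (retile (sym lower) mv) refl =
            ⊥-elim (notJ onJ)

  step-below : ∀ {i k d y'} → k < c → jRow k < i → ¬ OnPipeJ (i , k , d) → Step P (i , k , d) y' →
               Step ΦP (collapse (i , k , d)) (collapse y')
  step-below {suc i} {suc k} {d} k<c r<i notJ (stepDown mv)
    rewrite collapse-below {suc i} {d = d} k<c r<i | collapse-below {suc (suc i)} {d = fromTop} k<c (m<n⇒m<1+n r<i) =
    stepDown (retile (Φ-below (s≤s z≤n) k<c (≤-pred r<i)) mv)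
  step-below {suc i} {suc k} {d} k<c r<i notJ (stepLeft mv)
    rewrite collapse-below {suc i} {d = d} k<c r<i
          | collapse-below {suc i} {d = fromRight} (<-trans (n<1+n k) k<c) (leaving-below-jRow k<c r<i notJ mv) =
    stepLeft (retile (Φ-below (s≤s z≤n) k<c (≤-pred r<i)) mv)

  step-at-jRow : ∀ {k d y'} → k < c → ¬ OnPipeJ (jRow k , k , d) → Step P (jRow k , k , d) y' →
    (¬ Erased (jRow k , k , d) × Step ΦP (collapse (jRow k , k , d)) (collapse y')) ⊎
    collapse y' ≡ collapse (jRow k , k , d)
  step-at-jRow {k} {fromRight} k<c notJ _ = ⊥-elim (notJ (j-enters (≤-pred k<c)))
  step-at-jRow {suc k} {fromTop} k<c notJ (stepDown mv) =
    inj₂ (trans (collapse-below k<c ≤-refl) (sym (collapse-above k<c ≤-refl)))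
  step-at-jRow {suc k} {fromTop} k<c notJ (stepLeft mv)
    with jRow-bump-pair (s≤s z≤n) k<c (left-fromTop⇒bump mv)
  ... | upper , lower , _
    rewrite collapse-above {jRow (suc k)} {d = fromTop} k<c ≤-refl
          | collapse-above {jRow (suc k)} {d = fromRight} (<-trans (n<1+n k) k<c)
                           (jRow-antitone (n≤1+n k) (≤-pred k<c)) =
    inj₁ (¬Erased {d = fromTop} (λ p≡c → <-irrefl p≡c k<c) (λ _ _ → ¬cross) ,
          stepLeft (retile (trans (Φ-below (s≤s z≤n) k<c ≤-refl) lower) refl))
    where
    ¬cross : ¬ (P (jRow (suc k)) (suc k) ≡ cross)
    ¬cross is-cross = cross≢bump (trans (sym is-cross) upper)

  collapse-step : ∀ {y y'} → InStaircase m y → ¬ OnPipeJ y → Step P y y' →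
    (¬ Erased y × Step ΦP (collapse y) (collapse y')) ⊎ collapse y' ≡ collapse y
  collapse-step {i , k , d} ok notJ st with <-cmp c k
  ... | tri< c<k c≢k _ = inj₁ (¬Erased {d = d} (c≢k ∘ sym) (λ k<c → ⊥-elim (<-asym k<c c<k)) , step-right c<k st)
  ... | tri≈ _ refl _ = inj₂ (step-column ok notJ st)
  ... | tri> _ c≢k k<c with <-cmp i (jRow k)
  ...   | tri< i<r _ _ = inj₁ (¬Erased {d = d} (c≢k ∘ sym) (λ _ i≡r _ → <-irrefl i≡r i<r) , step-above k<c i<r st)
  ...   | tri≈ _ refl _ = step-at-jRow k<c notJ st
  ...   | tri> _ _ r<i =
    inj₁ (¬Erased {d = d} (c≢k ∘ sym) (λ _ i≡r _ → <-irrefl (sym i≡r) r<i) , step-below k<c r<i notJ st)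

  other-not-j : ∀ {p y} → p ≢ c → Reach P (1 , p , fromTop) y → ¬ OnPipeJ y
  other-not-j p≢c q r = p≢c (Reach-same-source q r)

  collapse-Reach : ∀ {p a w} → suc p ≤ m → suc p ≢ c → Reach P (1 , suc p , fromTop) a → Reach P a w →
                   Reach ΦP (collapse a) (collapse w)
  collapse-Reach p<m p≢c pa ε = ε
  collapse-Reach p<m p≢c pa (st ◅ q)
    with collapse-step (pipe-InStaircase antidiagonal p<m pa) (other-not-j p≢c pa) st
  ... | inj₁ (_ , st') = st' ◅ collapse-Reach p<m p≢c (pa ◅◅ return st) q
  ... | inj₂ eq = subst (λ s → Reach ΦP s _) eq (collapse-Reach p<m p≢c (pa ◅◅ return st) q)

  collapse-boundary : ∀ i d → ∃ λ i' → collapse (i , 0 , d) ≡ (i' , 0 , d)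
  collapse-boundary i d with jRow 0 <? i
  ... | yes r<i = pred i , collapse-below (s≤s z≤n) r<i
  ... | no r≮i = i , collapse-above (s≤s z≤n) (≮⇒≥ r≮i)

  collapse-Reach⁻¹ : ∀ {p a z} → suc p ≤ m → suc p ≢ c → Reach P (1 , suc p , fromTop) a → Reach P a z →
    col z ≡ 0 → ∀ {x} → Reach ΦP (collapse a) x → ∃ λ w → Reach P a w × collapse w ≡ x × ¬ Erased w
  collapse-Reach⁻¹ {a = i , _ , d} _ _ _ ε refl r with collapse-boundary i d
  ... | i' , eq with refl ← Reach-boundary (subst (λ s → Reach ΦP s _) eq r) =
    (i , 0 , d) , ε , eq , λ { (inj₁ ()) ; (inj₂ (() , _)) }
  collapse-Reach⁻¹ p<m p≢c pa (st ◅ q) z₀ r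
    with collapse-step (pipe-InStaircase antidiagonal p<m pa) (other-not-j p≢c pa) st
  ... | inj₂ eq
    with w , qw , hit , ne ← collapse-Reach⁻¹ p<m p≢c (pa ◅◅ return st) q z₀ (subst (λ s → Reach ΦP s _) (sym eq) r) =
    w , st ◅ qw , hit , ne
  ... | inj₁ (ne , st') with r
  ...   | ε = _ , ε , refl , ne
  ...   | st'' ◅ r' with refl ← Step-deterministic st' st''
    with w , qw , hit , ne' ← collapse-Reach⁻¹ p<m p≢c (pa ◅◅ return st) q z₀ r' =
    w , st ◅ qw , hit , ne'

  record CollapsedCell (a b i k : ℕ) : Set where
    field
      moves      : ∀ d → collapse (a , b , d) ≡ (i , k , d)
      col≥1      : 1 ≤ k
      row≤       : i ≤ a
      tile       : ΦP i k ≡ P a b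
      cross⇒origin : ΦP i k ≡ cross → origin i k ≡ (a , b)

  merged-cell : ∀ {k b} → 1 ≤ k → k < c → P (jRow k) k ≡ bump b → CollapsedCell (jRow k) k (jRow k) k
  merged-cell {k} k≥1 k<c is-bump = record
    { moves        = λ d → collapse-above k<c ≤-refl
    ; col≥1        = k≥1
    ; row≤         = ≤-refl
    ; tile         = trans Φ-merged (sym (proj₁ pair))
    ; cross⇒origin = λ is-cross → ⊥-elim (cross≢bump (trans (sym is-cross) Φ-merged))
    }
    where
    pair : P (jRow k) k ≡ bump false × P (suc (jRow k)) k ≡ bump false × OnPipeJ (suc (jRow k) , k , fromTop)
    pair = jRow-bump-pair k≥1 k<c (_ , is-bump)

    Φ-merged : ΦP (jRow k) k ≡ bump false
    Φ-merged = trans (Φ-below k≥1 k<c ≤-refl) (proj₁ (proj₂ pair))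

  shifted-cell : ∀ {a k} → 1 ≤ k → k < c → jRow k < a → CollapsedCell a k (pred a) k
  shifted-cell {suc a} k≥1 k<c r<a = record
    { moves        = λ d → collapse-below k<c r<a
    ; col≥1        = k≥1
    ; row≤         = n≤1+n a
    ; tile         = Φ-below k≥1 k<c (≤-pred r<a)
    ; cross⇒origin = λ _ → origin-below k<c (≤-pred r<a)
    }

  collapse-cell : ∀ {a b} → ¬ Erased (a , b , fromTop) → 1 ≤ b → ∃ λ i → ∃ λ k → CollapsedCell a b i k
  collapse-cell {a} {suc b} ne _ with <-cmp c (suc b)
  ... | tri< c<b _ _ = a , b , record
    { moves = λ d → collapse-right c<b
    ; col≥1 = ≤-trans (s≤s z≤n) (≤-pred c<b)
    ; row≤ = ≤-refl
    ; tile = Φ-right {v} {j} {P} (≤-pred c<b)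
    ; cross⇒origin = λ _ → origin-right (≤-pred c<b) }
  ... | tri≈ _ refl _ = ⊥-elim (ne (inj₁ refl))
  ... | tri> _ _ b<c with <-cmp a (jRow (suc b))
  ...   | tri< a<r _ _ = a , suc b , record
    { moves = λ d → collapse-above b<c (<⇒≤ a<r)
    ; col≥1 = s≤s z≤n
    ; row≤ = ≤-refl
    ; tile = Φ-above (s≤s z≤n) b<c a<r
    ; cross⇒origin = λ _ → origin-above b<c a<r }
  ...   | tri> _ _ r<a = pred a , suc b , shifted-cell (s≤s z≤n) b<c r<a
  ...   | tri≈ _ refl _ with P a (suc b) in tile
  ...     | cross  = ⊥-elim (ne (inj₂ (s≤s z≤n , b<c , refl , refl)))
  ...     | bump _ = a , suc b , merged-cell (s≤s z≤n) b<c tile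

  collapse-origin : ∀ i k d → collapse (proj₁ (origin i k) , proj₂ (origin i k) , d) ≡ (i , k , d)
  collapse-origin i k d with <-cmp k c
  ... | tri< k<c _ _ with <-cmp i (jRow k)
  ...   | tri< i<r _ _ rewrite origin-above k<c i<r = collapse-above k<c (<⇒≤ i<r)
  ...   | tri≈ _ i≡r _ rewrite origin-below k<c (≤-reflexive (sym i≡r)) =
    collapse-below k<c (s≤s (≤-reflexive (sym i≡r)))
  ...   | tri> _ _ r<i rewrite origin-below k<c (<⇒≤ r<i) = collapse-below k<c (m<n⇒m<1+n r<i)
  collapse-origin i k d | tri≈ _ refl _ rewrite origin-right {i} {k} ≤-refl = collapse-right ≤-refl
  collapse-origin i k d | tri> _ _ c<k rewrite origin-right {i} {k} (<⇒≤ c<k) = collapse-right (m<n⇒m<1+n c<k)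

  origin-injective : ∀ {i k i' k'} → origin i k ≡ origin i' k' → (i , k) ≡ (i' , k')
  origin-injective {i} {k} {i'} {k'} eq = cong (λ s → row s , col s) (begin
    (i , k , fromTop)                                                 ≡⟨ sym (collapse-origin i k fromTop) ⟩
    collapse (proj₁ (origin i k) , proj₂ (origin i k) , fromTop)     ≡⟨ cong (λ o → collapse (proj₁ o , proj₂ o , fromTop)) eq ⟩
    collapse (proj₁ (origin i' k') , proj₂ (origin i' k') , fromTop) ≡⟨ collapse-origin i' k' fromTop ⟩
    (i' , k' , fromTop)                                               ∎)
    where open ≡-Reasoning

  v' : List ℕ
  v' = deleteEntry j v

  m' : ℕ
  m' = length v'

  m≡1+m' : m ≡ suc m'
  m≡1+m' = length-deleteEntry v v-unique j∈v

  origin-shape : ∀ i k → (origin i k ≡ (i , k) × i + k < m) ⊎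
                         (origin i k ≡ (suc i , k) × k < c × jRow k ≤ i) ⊎ origin i k ≡ (i , suc k)
  origin-shape i k with <-cmp c k
  ... | tri< c<k _ _ = inj₂ (inj₂ (origin-right (<⇒≤ c<k)))
  ... | tri≈ _ refl _ = inj₂ (inj₂ (origin-right ≤-refl))
  ... | tri> _ _ k<c with <-cmp (jRow k) i
  ...   | tri> _ _ i<r = inj₁ (origin-above k<c i<r , <-≤-trans (+-monoˡ-< k i<r) (jRow+k≤m (≤-pred k<c)))
  ...   | tri≈ _ refl _ = inj₂ (inj₁ (origin-below k<c ≤-refl , k<c , ≤-refl))
  ...   | tri< r<i _ _ = inj₂ (inj₁ (origin-below k<c (<⇒≤ r<i) , k<c , <⇒≤ r<i))

  origin-InStair : ∀ {i k} → InStair m' i k → InStair m (proj₁ (origin i k)) (proj₂ (origin i k))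
  origin-InStair {i} {k} (i≥1 , k≥1 , bound) with origin-shape i k
  ... | inj₁ (eq , _) rewrite eq = i≥1 , k≥1 , ≤-trans bound (≤-trans (≤-reflexive (sym m≡1+m')) (n≤1+n m))
  ... | inj₂ (inj₁ (eq , _)) rewrite eq = s≤s z≤n , k≥1 , subst (suc (i + k) ≤_) (cong suc (sym m≡1+m')) (s≤s bound)
  ... | inj₂ (inj₂ eq) rewrite eq = i≥1 , s≤s z≤n , subst₂ _≤_ (sym (+-suc i k)) (cong suc (sym m≡1+m')) (s≤s bound)

  origin-antidiagonal : ∀ {i k} → i + k ≡ m → proj₁ (origin i k) + proj₂ (origin i k) ≡ suc m
  origin-antidiagonal {i} {k} i+k≡m with origin-shape i k
  ... | inj₁ (_ , i+k<m) = ⊥-elim (<-irrefl i+k≡m i+k<m)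
  ... | inj₂ (inj₁ (eq , _)) rewrite eq = cong suc i+k≡m
  ... | inj₂ (inj₂ eq) rewrite eq = trans (+-suc i k) (cong suc i+k≡m)

  Φ-antidiagonal : BumpsOnAntidiagonal m' ΦP
  Φ-antidiagonal i k i≥1 k≥1 i+k≡ rewrite Φ-origin i k k≥1 with origin-InStair (i≥1 , k≥1 , ≤-reflexive i+k≡)
  ... | a≥1 , b≥1 , _ = antidiagonal _ _ a≥1 b≥1 (origin-antidiagonal {i} {k} (trans i+k≡ (sym m≡1+m')))

  lift-pipe : ∀ {k} → 1 ≤ k → k ≤ m' → ∃ λ p → suc p ≤ m × suc p ≢ c ×
    collapse (1 , suc p , fromTop) ≡ (1 , k , fromTop) × (suc p ≡ k × k < c ⊎ p ≡ k × c ≤ k)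
  lift-pipe {suc k} _ k≤m' with suc k <? c
  ... | yes k<c = k , ≤-trans k≤m' (≤-trans (n≤1+n m') (≤-reflexive (sym m≡1+m'))) , (λ p≡c → <-irrefl p≡c k<c) ,
                  collapse-above k<c (jRow≥1 (≤-pred k<c)) , inj₁ (refl , k<c)
  ... | no k≮c = suc k , subst (suc (suc k) ≤_) (sym m≡1+m') (s≤s k≤m') , (λ p≡c → k≮c (≤-reflexive p≡c)) ,
                 collapse-right (s≤s (≮⇒≥ k≮c)) , inj₂ (refl , ≮⇒≥ k≮c)

  lower-pipe : ∀ {p} → suc p ≤ m → suc p ≢ c →
    ∃ λ k → collapse (1 , suc p , fromTop) ≡ (1 , suc k , fromTop) × suc k ≤ m'
  lower-pipe {p} p<m p≢c with <-cmp c (suc p)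
  ... | tri> _ _ p<c = p , collapse-above p<c (jRow≥1 (≤-pred p<c)) ,
                       ≤-pred (subst (suc (suc p) ≤_) m≡1+m' (<-≤-trans p<c c₀<m))
  ... | tri≈ _ c≡p _ = ⊥-elim (p≢c (sym c≡p))
  ... | tri< c<p _ _ = shift p c<p p<m
    where
    shift : ∀ p → c < suc p → suc p ≤ m → ∃ λ k → collapse (1 , suc p , fromTop) ≡ (1 , suc k , fromTop) × suc k ≤ m'
    shift zero    (s≤s ()) _
    shift (suc k) c<p p<m = k , collapse-right c<p , ≤-pred (subst (suc (suc k) ≤_) m≡1+m' p<m)

  P-reading : ∀ {p} → p < m → ∃ λ (e : Fin m) → pipeExit P m (suc p) ≡ just (suc (toℕ e)) × rank v (lookup v e) ≡ p
  P-reading p<m with reading (fromℕ< p<m)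
  ... | e , ex , rk rewrite toℕ-fromℕ< p<m = e , ex , rk

  j-exit : ∃ λ (q : Fin m) → lookup v q ≡ j × jRow 0 ≡ suc (toℕ q)
  j-exit with P-reading c₀<m
  ... | q , ex , rk =
    q , rank-injective v (∈-lookup q) j∈v rk , Reach-exit-unique (j-enters z≤n) (pipeExit⇒Reach {m = m} ex)

  label≢j : ∀ {p} → suc p ≢ c → (e q : Fin m) → rank v (lookup v e) ≡ p → lookup v q ≡ j → toℕ e ≢ toℕ q
  label≢j p≢c e q rk vq≡j e≡q =
    p≢c (cong suc (trans (sym rk) (trans (cong (rank v ∘ lookup v) (toℕ-injective e≡q)) (cong (rank v) vq≡j))))

  rank-delete-label : ∀ {a p k} → a ∈ v → rank v a ≡ p → (suc p ≡ k × k < c ⊎ p ≡ k × c ≤ k) →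
                      suc (rank v' a) ≡ k
  rank-delete-label {a} a∈v rk (inj₁ (refl , p<c₀)) = cong suc (trans (rank-deleteEntry-≮ v j≮a) rk)
    where
    j≮a : ¬ j < a
    j≮a j<a = <-asym (subst (c₀ <_) rk (rank-strict v j<a j∈v)) (≤-pred p<c₀)
  rank-delete-label {a} a∈v rk (inj₂ (refl , c≤p)) = trans (sym (rank-deleteEntry-< v v-unique j∈v j<a)) rk
    where
    j<a : j < a
    j<a with <-cmp j a
    ... | tri< j<a _ _ = j<a
    ... | tri≈ _ refl _ = ⊥-elim (<-irrefl rk c≤p)
    ... | tri> _ _ a<j = ⊥-elim (<-asym (subst (_< c₀) rk (rank-strict v a<j a∈v)) c≤p)

  push-pipe : ∀ {p q y} → suc p ≤ m → suc p ≢ c → collapse (1 , suc p , fromTop) ≡ (1 , q , fromTop) →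
              Reach P (1 , suc p , fromTop) y → Reach ΦP (1 , q , fromTop) (collapse y)
  push-pipe p<m p≢c start r = subst (λ s → Reach ΦP s _) start (collapse-Reach p<m p≢c ε r)

  Φ-reading : ∀ (k : Fin m') → ∃ λ (r : Fin m') →
    pipeExit ΦP m' (suc (toℕ k)) ≡ just (suc (toℕ r)) × rank v' (lookup v' r) ≡ toℕ k
  Φ-reading k with lift-pipe (s≤s z≤n) (toℕ<n k)
  ... | p , p<m , p≢c , start , which with P-reading p<m | j-exit
  ... | e , ex , rk | q , vq≡j , r₀≡q with lookup-deleteEntry v v-unique q e vq≡j (label≢j p≢c e q rk vq≡j)
  ... | r , same , before , after = r , exit-row , rank-row
    where
    collapsed-exit : collapse (suc (toℕ e) , 0 , fromRight) ≡ (suc (toℕ r) , 0 , fromRight)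
    collapsed-exit with <-cmp (toℕ e) (toℕ q)
    ... | tri< e<q _ _ = trans (collapse-above (s≤s z≤n) (subst (suc (toℕ e) ≤_) (sym r₀≡q) (s≤s (<⇒≤ e<q))))
                               (cong (λ x → suc x , 0 , fromRight) (sym (before e<q)))
    ... | tri≈ _ e≡q _ = ⊥-elim (label≢j p≢c e q rk vq≡j e≡q)
    ... | tri> _ _ q<e = trans (collapse-below (s≤s z≤n) (subst (_< suc (toℕ e)) (sym r₀≡q) (s≤s q<e)))
                               (cong (λ x → x , 0 , fromRight) (sym (after q<e)))

    exit-row : pipeExit ΦP m' (suc (toℕ k)) ≡ just (suc (toℕ r))
    exit-row = Reach⇒pipeExit Φ-antidiagonal (toℕ<n k)
                 (subst (Reach ΦP _) collapsed-exit (push-pipe p<m p≢c start (pipeExit⇒Reach {m = m} ex)))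

    rank-row : rank v' (lookup v' r) ≡ toℕ k
    rank-row rewrite same = suc-injective (rank-delete-label (∈-lookup e) rk which)

  pull-crossing : ∀ {p k i cc} → suc p ≤ m → suc p ≢ c → collapse (1 , suc p , fromTop) ≡ (1 , suc k , fromTop) →
    1 ≤ cc → ΦP i cc ≡ cross → Visits ΦP m' (suc k) i cc →
    ∃ λ a → ∃ λ b → origin i cc ≡ (a , b) × P a b ≡ cross × InStair m a b × Visits P m (suc p) a b
  pull-crossing {i = i} {cc} p<m p≢c start cc≥1 is-cross (d , en) with P-reading p<m
  ... | _ , ex , _ with collapse-Reach⁻¹ p<m p≢c ε (pipeExit⇒Reach {m = m} ex) refl
                         (subst (λ s → Reach ΦP s (i , cc , d)) (sym start) (Enters⇒Reach {ΦP} {m'} en))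
  ... | (a , zero , d') , _ , hit , _ with collapse-boundary a d'
  ...   | _ , eq = ⊥-elim (<-irrefl (trans (sym (cong col eq)) (cong col hit)) cc≥1)
  pull-crossing p<m p≢c start cc≥1 is-cross _ | _ | (a , suc b , d') , reach , hit , ne
    with collapse-cell ne (s≤s z≤n)
  ... | i₀ , k₀ , cell with refl ← trans (sym (CollapsedCell.moves cell d')) hit =
    a , suc b , CollapsedCell.cross⇒origin cell is-cross , trans (sym (CollapsedCell.tile cell)) is-cross ,
    InStaircase⇒InStair (pipe-InStaircase antidiagonal p<m reach) (s≤s z≤n) ,
    d' , Reach⇒Enters antidiagonal p<m reach (s≤s z≤n)

  lifts-distinct : ∀ {p₁ p₂ k₁ k₂} → collapse (1 , p₁ , fromTop) ≡ (1 , k₁ , fromTop) →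
                   collapse (1 , p₂ , fromTop) ≡ (1 , k₂ , fromTop) → k₁ ≢ k₂ → p₁ ≢ p₂
  lifts-distinct start₁ start₂ k₁≢k₂ refl = k₁≢k₂ (cong col (trans (sym start₁) start₂))

  Φ-reduced : ∀ k₁ k₂ → IsPipe m' k₁ → IsPipe m' k₂ → k₁ ≢ k₂ →
    ∀ i cc i' cc' → InStair m' i cc → InStair m' i' cc' → ΦP i cc ≡ cross → ΦP i' cc' ≡ cross →
    Visits ΦP m' k₁ i cc → Visits ΦP m' k₂ i cc → Visits ΦP m' k₁ i' cc' → Visits ΦP m' k₂ i' cc' →
    i ≡ i' × cc ≡ cc'
  Φ-reduced (suc k₁) (suc k₂) (_ , k₁≤m') (_ , k₂≤m') k₁≢k₂ i cc i' cc' (_ , cc≥1 , _) (_ , cc'≥1 , _)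
            X X' v₁ v₂ v₃ v₄
    with lift-pipe (s≤s z≤n) k₁≤m' | lift-pipe (s≤s z≤n) k₂≤m'
  ... | p₁ , p₁<m , p₁≢c , start₁ , _ | p₂ , p₂<m , p₂≢c , start₂ , _
    with pull-crossing p₁<m p₁≢c start₁ cc≥1 X v₁  | pull-crossing p₂<m p₂≢c start₂ cc≥1 X v₂
       | pull-crossing p₁<m p₁≢c start₁ cc'≥1 X' v₃ | pull-crossing p₂<m p₂≢c start₂ cc'≥1 X' v₄
  ... | a , b , o , Y , st , w₁ | _ , _ , o₂ , _ , _ , w₂ | a' , b' , o' , Y' , st' , w₃ | _ , _ , o₄ , _ , _ , w₄
    with refl ← trans (sym o) o₂ | refl ← trans (sym o') o₄
    with refl , refl ← reduced (suc p₁) (suc p₂) (s≤s z≤n , p₁<m) (s≤s z≤n , p₂<m) (lifts-distinct start₁ start₂ k₁≢k₂)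
                               a b a' b' st st' Y Y' w₁ w₂ w₃ w₄
    with refl ← origin-injective (trans o (sym o')) = refl , refl

  erased-on-j : ∀ {a b d} → InStair m a b → P a b ≡ cross → Erased (a , b , d) → ∃ λ dj → OnPipeJ (a , b , dj)
  erased-on-j {a} (a≥1 , _ , bound) is-cross (inj₁ refl) with a ≤? t
  ... | yes a≤t = fromTop , j-column a≥1 (m≤n⇒m≤1+n a≤t)
  ... | no a≰t with () ← trans (sym (column-bumps (≰⇒> a≰t) bound)) is-cross
  erased-on-j _ _ (inj₂ (_ , b<c , refl , _)) = fromRight , j-enters (≤-pred b<c)

  shared-crossing-not-erased : ∀ {p₁ p₂ a b d₁ d₂} → p₁ ≢ p₂ → p₁ ≢ c → p₂ ≢ c → InStair m a b → P a b ≡ cross →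
    Reach P (1 , p₁ , fromTop) (a , b , d₁) → Reach P (1 , p₂ , fromTop) (a , b , d₂) → ¬ Erased (a , b , d₁)
  shared-crossing-not-erased {d₁ = d₁} p₁≢p₂ p₁≢c p₂≢c inst is-cross r₁ r₂ er
    with erased-on-j {d = d₁} inst is-cross er
  ... | _ , onJ = Reach-three-pipes p₁≢p₂ p₁≢c p₂≢c r₁ r₂ onJ

  -- The pipe entering (i + 1 , cc) from the right met the other one further right in row i. Right of c,
  -- the pipe entering from the top would then cross column c horizontally in row i ≤ t, impossible as
  -- t + 1 = r_{c-1} ≤ r_cc ≤ i.
  crossing-above-merged : ∀ {p₁ p₂ i cc c'' d₁ d₂} → suc p₁ ≤ m → cc < c → jRow cc ≤ i →
    Reach P (1 , suc p₁ , fromTop) (suc i , cc , fromTop) → Reach P (1 , p₂ , fromTop) (suc i , cc , fromRight) →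
    Reach P (1 , suc p₁ , fromTop) (i , c'' , d₁) → Reach P (1 , p₂ , fromTop) (i , c'' , d₂) →
    P i c'' ≡ cross → ¬ Erased (i , c'' , d₁) → c'' < c × jRow c'' < i
  crossing-above-merged {i = i} {cc} {c''} p₁<m cc<c r≤i y₁ y₂ z₁ z₂ is-cross ne
    with Reach-fromRight-below y₂ z₂ | <-cmp c'' c
  ... | cc<c'' | tri< c''<c _ _ =
    c''<c , ≤∧≢⇒< (≤-trans (jRow-antitone (<⇒≤ cc<c'') (≤-pred c''<c)) r≤i)
                  (λ r≡i → ne (inj₂ (≤-trans (s≤s z≤n) cc<c'' , c''<c , sym r≡i , is-cross)))
  ... | _ | tri≈ _ refl _ = ⊥-elim (ne (inj₁ refl))
  ... | _ | tri> _ _ c<c'' with Reach-fromTop-below y₁ z₁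
  ...   | _ , z→u with Reach-along-row z→u refl cc<c c<c''
  ...     | z→c , turns with i ≤? t
  ...       | yes i≤t = ⊥-elim (<-irrefl refl (begin-strict
                i                ≤⟨ i≤t ⟩
                t                <⟨ n<1+n t ⟩
                suc t            ≡⟨ sym jRow-c₀ ⟩
                jRow c₀          ≤⟨ jRow-antitone (≤-pred cc<c) ≤-refl ⟩
                jRow cc          ≤⟨ r≤i ⟩
                i                ∎))
    where open ≤-Reasoning
  ...       | no i≰t
    with () ← trans (sym (column-bumps (≰⇒> i≰t) (proj₁ (proj₂ (pipe-InStaircase antidiagonal p₁<m (z₁ ◅◅ z→c))))))
                    (left-fromRight⇒cross turns)

  mark-row : ∀ {i cc a b p₁ p₂ i'' c'' d₁ d₂ i₃ k₃} → suc p₁ ≤ m → origin i cc ≡ (a , b) → i'' < a →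
    Reach P (1 , suc p₁ , fromTop) (a , b , fromTop) → Reach P (1 , p₂ , fromTop) (a , b , fromRight) →
    Reach P (1 , suc p₁ , fromTop) (i'' , c'' , d₁) → Reach P (1 , p₂ , fromTop) (i'' , c'' , d₂) →
    P i'' c'' ≡ cross → ¬ Erased (i'' , c'' , d₁) → CollapsedCell i'' c'' i₃ k₃ → i₃ < i
  mark-row {i} {cc} p₁<m o i''<a y₁ y₂ z₁ z₂ is-cross ne cell with origin-shape i cc
  ... | inj₁ (o' , _) with refl ← trans (sym o') o = ≤-<-trans (CollapsedCell.row≤ cell) i''<a
  ... | inj₂ (inj₂ o') with refl ← trans (sym o') o = ≤-<-trans (CollapsedCell.row≤ cell) i''<a
  ... | inj₂ (inj₁ (o' , cc<c , r≤i)) with refl ← trans (sym o') o with m≤n⇒m<n∨m≡n (≤-pred i''<a)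
  ...   | inj₁ i''<i = ≤-<-trans (CollapsedCell.row≤ cell) i''<i
  ...   | inj₂ refl with crossing-above-merged p₁<m cc<c r≤i y₁ y₂ z₁ z₂ is-cross ne
  ...     | c''<c , r<i =
    subst (_< i) (cong row (trans (sym (collapse-below c''<c r<i)) (CollapsedCell.moves cell fromTop))) (pred< r<i)
    where
    pred< : ∀ {x y} → x < y → pred y < y
    pred< {y = suc y} _ = ≤-refl

  marked-not-j : ∀ {a b p d} → InStair m a b → P a b ≡ bump true → Enters P m p a b d → p ≢ c
  marked-not-j inst marked en refl = noMarked _ _ inst (_ , en) marked

  entering-distinct : ∀ {p₁ p₂ a b} → Enters P m (suc p₁) a b fromTop → Enters P m (suc p₂) a b fromRight →
                      suc p₁ ≢ suc p₂
  entering-distinct {a = a} {b} en₁ en₂ refl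
    with () ← Reach-cell-direction (Enters⇒Reach {P} {m} en₁) (Enters⇒Reach {P} {m} en₂)

  push-enters : ∀ {p q a b d i k d'} → suc p ≤ m → suc p ≢ c → collapse (1 , suc p , fromTop) ≡ (1 , suc q , fromTop) →
    suc q ≤ m' → collapse (a , b , d) ≡ (i , k , d') → 1 ≤ k → Enters P m (suc p) a b d → Enters ΦP m' (suc q) i k d'
  push-enters p<m p≢c start q<m' image k≥1 en =
    Reach⇒Enters Φ-antidiagonal q<m' (subst (Reach ΦP _) image (push-pipe p<m p≢c start (Enters⇒Reach {P} {m} en))) k≥1

  lift-mark : ∀ {i cc a b} → 1 ≤ cc → origin i cc ≡ (a , b) → InStair m a b → P a b ≡ bump true →
              MarkJustified ΦP m' i cc
  lift-mark {i} {cc} {a} {b} cc≥1 o inst marked with marks a b inst marked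
  ... | zero , _ , (() , _) , _
  ... | suc _ , zero , _ , (() , _) , _
  ... | suc p₁ , suc p₂ , (_ , p₁<m) , (_ , p₂<m) , en₁ , en₂ , i'' , c'' , i''<a , instZ , crZ ,
        (d₁ , vz₁) , (d₂ , vz₂)
    with marked-not-j inst marked en₁ | marked-not-j inst marked en₂ | entering-distinct en₁ en₂
  ... | p₁≢c | p₂≢c | p₁≢p₂
    with lower-pipe p₁<m p₁≢c | lower-pipe p₂<m p₂≢c
       | shared-crossing-not-erased p₁≢p₂ p₁≢c p₂≢c instZ crZ (Enters⇒Reach {P} {m} vz₁) (Enters⇒Reach {P} {m} vz₂)
  ... | q₁ , start₁ , q₁<m' | q₂ , start₂ , q₂<m' | ne with collapse-cell ne (proj₁ (proj₂ instZ))
  ... | i₃ , k₃ , cell =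
    suc q₁ , suc q₂ , (s≤s z≤n , q₁<m') , (s≤s z≤n , q₂<m') ,
    push-enters p₁<m p₁≢c start₁ q₁<m' (image fromTop) cc≥1 en₁ ,
    push-enters p₂<m p₂≢c start₂ q₂<m' (image fromRight) cc≥1 en₂ ,
    i₃ , k₃ ,
    mark-row p₁<m o i''<a (Enters⇒Reach {P} {m} en₁) (Enters⇒Reach {P} {m} en₂)
             (Enters⇒Reach {P} {m} vz₁) (Enters⇒Reach {P} {m} vz₂) crZ ne cell ,
    InStaircase⇒InStair (pipe-InStaircase Φ-antidiagonal q₁<m' (Enters⇒Reach {ΦP} {m'} visits₁)) col≥1 ,
    trans tile crZ ,
    (d₁ , visits₁) ,
    (d₂ , push-enters p₂<m p₂≢c start₂ q₂<m' (moves d₂) col≥1 vz₂)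
    where
    open CollapsedCell cell
    image : ∀ d → collapse (a , b , d) ≡ (i , cc , d)
    image d = trans (cong (λ o → collapse (proj₁ o , proj₂ o , d)) (sym o)) (collapse-origin i cc d)
    visits₁ : Enters ΦP m' (suc q₁) i₃ k₃ d₁
    visits₁ = push-enters p₁<m p₁≢c start₁ q₁<m' (moves d₁) col≥1 vz₁

  Φ-marks : ∀ i cc → InStair m' i cc → ΦP i cc ≡ bump true → MarkJustified ΦP m' i cc
  Φ-marks i cc inst marked =
    lift-mark cc≥1 refl (origin-InStair inst) (trans (sym (Φ-origin i cc cc≥1)) marked)
    where
    cc≥1 = proj₁ (proj₂ inst)

  Φ-dream : MarkedReducedPipeDream v' ΦP
  Φ-dream = record
    { antidiagonal = Φ-antidiagonal
    ; reading      = Φ-reading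
    ; reduced      = Φ-reduced
    ; marks        = Φ-marks
    }

proposition3p1 : (v : List ℕ) → Unique v → All (1 ≤_) v →
    (P : Filling) → MarkedReducedPipeDream v P →
    (j : ℕ) → j ∈ v → Removable v j P →
    MarkedReducedPipeDream (deleteEntry j v) (Φ v j P)
-- Positivity of the entries plays no role; only their relative order does.
proposition3p1 v v-unique _ P dream j j∈v removable = PipeRemoval.Φ-dream v v-unique P dream j j∈v removable
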